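{- Let $n$ be a positive multiple of $3$ and let $f(x_1,\ldots,x_n)=x_1x_2x_3\vee x_4x_5x_6\vee\cdots\vee x_{n-2}x_{n-1}x_n$. Then $\Gamma(f)=3^{n/3}\cdot(n/3)$.
   Context: A partial assignment is $b\in\{0,1,*\}^n$; $a\succeq b$ means $a_i=b_i$ whenever $b_i\ne *$. $b$ is a $0$-certificate (resp. $1$-certificate) of $f$ if $f(a)=0$ (resp. $1$) for all $a\in\{0,1\}^n$ with $a\succeq b$; a certificate is a $0$- or $1$-certificate; $b$ contains a certificate if $b\succeq c$ for some certificate $c$. For $b_i=*$, $b_{x_i\leftarrow\ell}$ is $b$ with coordinate $i$ set to $\ell\in\{0,1\}$. $g:\{0,1,*\}^n\to\mathbb{Z}_{\ge0}$ is monotone if $g(b_{x_i\leftarrow\ell})\ge g(b)$ whenever $b_i=*$, and submodular if $g(b_{x_i\leftarrow\ell})-g(b)\ge g(b'_{x_i\leftarrow\ell})-g(b')$ whenever $b'\succeq b$, $b_i=b'_i=*$. A goal function for $f$ is a monotone submodular $g$ with an integer $Q\ge0$ (its goal value) such that $g(b)=Q$ for all $b\in\{0,1\}^n$ and $g(b)=Q$ iff $b$ contains a certificate of $f$. $\Gamma(f)$ is the minimum goal value of a goal function for $f$. -}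

module Defs where

open import Data.Nat using (ℕ; zero; suc; _+_; _*_; _≤_)
open import Data.Bool using (Bool; true; false; _∧_; _∨_)
open import Data.Maybe using (Maybe; just; nothing)
open import Data.Fin using (Fin)
open import Data.Vec using (Vec; []; _∷_; lookup; map; _[_]≔_)
open import Data.Product using (Σ; _×_; ∃)
open import Function.Bundles using (_⇔_)
open import Relation.Binary.PropositionalEquality using (_≡_)

-- Partial assignment: nothing = *, just ℓ = ℓ.
PartialAssignment : ℕ → Set
PartialAssignment n = Vec (Maybe Bool) n

total : ∀ {n} → Vec Bool n → PartialAssignment n
total a = map just a

_⪰_ : ∀ {n} → PartialAssignment n → PartialAssignment n → Set
_⪰_ {n} a b = ∀ (i : Fin n) (ℓ : Bool) → lookup b i ≡ just ℓ → lookup a i ≡ just ℓ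

IsCertificateOf : ∀ {n} → (Vec Bool n → Bool) → Bool → PartialAssignment n → Set
IsCertificateOf {n} f ℓ b = ∀ (a : Vec Bool n) → total a ⪰ b → f a ≡ ℓ

IsCertificate : ∀ {n} → (Vec Bool n → Bool) → PartialAssignment n → Set
IsCertificate f b = Σ Bool (λ ℓ → IsCertificateOf f ℓ b)

ContainsCertificate : ∀ {n} → (Vec Bool n → Bool) → PartialAssignment n → Set
ContainsCertificate {n} f b = Σ (PartialAssignment n) (λ c → IsCertificate f c × b ⪰ c)

assign : ∀ {n} → PartialAssignment n → Fin n → Bool → PartialAssignment n
assign b i ℓ = b [ i ]≔ just ℓ

Monotone : ∀ {n} → (PartialAssignment n → ℕ) → Set
Monotone {n} g = ∀ (b : PartialAssignment n) (i : Fin n) (ℓ : Bool) →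
  lookup b i ≡ nothing → g b ≤ g (assign b i ℓ)

-- g(b_{i←ℓ}) - g(b) ≥ g(b'_{i←ℓ}) - g(b'), written additively over ℕ
-- (equivalent to the integer inequality).
Submodular : ∀ {n} → (PartialAssignment n → ℕ) → Set
Submodular {n} g = ∀ (b b' : PartialAssignment n) (i : Fin n) (ℓ : Bool) →
  b' ⪰ b → lookup b i ≡ nothing → lookup b' i ≡ nothing →
  g (assign b' i ℓ) + g b ≤ g (assign b i ℓ) + g b'

record IsGoalFunction {n} (f : Vec Bool n → Bool) (g : PartialAssignment n → ℕ) (Q : ℕ) : Set where
  field
    monotone    : Monotone g
    submodular  : Submodular g
    total-goal  : ∀ (a : Vec Bool n) → g (total a) ≡ Q
    goal-iff    : ∀ (b : PartialAssignment n) → (g b ≡ Q) ⇔ ContainsCertificate f b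

Γ≡ : ∀ {n} → (Vec Bool n → Bool) → ℕ → Set
Γ≡ {n} f m =
  Σ (PartialAssignment n → ℕ) (λ g → IsGoalFunction f g m) ×
  (∀ (g : PartialAssignment n → ℕ) (Q : ℕ) → IsGoalFunction f g Q → m ≤ Q)

tribes : ∀ k → Vec Bool (k * 3) → Bool
tribes zero [] = false
tribes (suc k) (x ∷ y ∷ z ∷ v) = (x ∧ y ∧ z) ∨ tribes k v

-- Let A(b) be the number of terms not falsified by b and U(b) the product, over all terms,
-- of the numbers of their variables not set to 1.  Then g(b) = 3^k·k − A(b)·U(b) is a goal
-- function: A·U vanishes exactly when b contains a certificate, and it is antitone and
-- supermodular because it is built from one-coordinate functions by sums and products.
-- Conversely, let W(b) be the product, over the live terms, of their numbers of free
-- variables.  If A(b)·W(b) ≥ 2, there are a free x_i, a value ℓ and an extension b′ of b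
-- with x_i free such that A·W(b) = A·W(b_{x_i←ℓ}) + A·W(b′), both summands positive, and
-- b′_{x_i←ℓ} contains a certificate.  For a goal function g with goal value Q,
-- submodularity then gives Q − g(b) ≥ (Q − g(b_{x_i←ℓ})) + (Q − g(b′)), so
-- Q − g(b) ≥ A(b)·W(b) by induction, and A·W is k·3^k on the empty assignment.
module Submission where

open import Defs
open import Data.Nat using (ℕ; zero; suc; _+_; _*_; _∸_; _^_; _≤_; _<_; z≤n; s≤s)
open import Data.Nat.Properties
open import Data.Nat.Induction using (<-wellFounded)
open import Data.Nat.Tactic.RingSolver using (solve-∀)
open import Algebra.Properties.CommutativeSemigroup +-commutativeSemigroup using (interchange)
open import Induction.WellFounded using (Acc; acc)
open import Data.Bool using (Bool; true; false; not; _∧_; _∨_; if_then_else_; f≤t; b≤b)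
  renaming (_≤_ to _≤ᵇ_)
import Data.Bool.Properties as Boolₚ
open import Data.Maybe using (Maybe; just; nothing; fromMaybe)
open import Data.Fin using (Fin; zero; suc)
open import Data.Vec using (Vec; []; _∷_; lookup; map; replicate; head; tail)
open import Data.Vec.Relation.Binary.Pointwise.Inductive as Pointwise using (Pointwise; []; _∷_)
open import Data.Product using (Σ; _×_; _,_; proj₁; proj₂)
open import Data.Sum using (_⊎_; inj₁; inj₂; [_,_]′)
import Data.Sum as Sum
open import Function.Bundles using (_⇔_; mk⇔; Equivalence)
open import Relation.Binary.PropositionalEquality
  using (_≡_; _≢_; refl; sym; trans; cong; cong₂; subst; module ≡-Reasoning)
open Equivalence using (to; from)

Refines : Maybe Bool → Maybe Bool → Set
Refines x′ x = ∀ ℓ → x ≡ just ℓ → x′ ≡ just ℓ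

refines-refl : ∀ {x} → Refines x x
refines-refl ℓ x≡ℓ = x≡ℓ

refines-trans : ∀ {x x′ x″} → Refines x″ x′ → Refines x′ x → Refines x″ x
refines-trans x″⊒x′ x′⊒x ℓ x≡ℓ = x″⊒x′ ℓ (x′⊒x ℓ x≡ℓ)

refines-free : ∀ {x′} → Refines x′ nothing
refines-free ℓ ()

infix 4 _⊒_

-- An inductive copy of _⪰_, so that the vectors can be inferred from a proof.
_⊒_ : ∀ {n} → PartialAssignment n → PartialAssignment n → Set
_⊒_ = Pointwise Refines

⊒-refl : ∀ {n} {b : PartialAssignment n} → b ⊒ b
⊒-refl = Pointwise.refl refines-refl

⊒-trans : ∀ {n} {a b c : PartialAssignment n} → a ⊒ b → b ⊒ c → a ⊒ c
⊒-trans = Pointwise.trans refines-trans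

⊒⇒⪰ : ∀ {n} {b b′ : PartialAssignment n} → b′ ⊒ b → b′ ⪰ b
⊒⇒⪰ = Pointwise.lookup

⪰⇒⊒ : ∀ {n} (b′ b : PartialAssignment n) → b′ ⪰ b → b′ ⊒ b
⪰⇒⊒ []        []      _     = []
⪰⇒⊒ (x′ ∷ v′) (x ∷ v) b′⪰b = b′⪰b zero ∷ ⪰⇒⊒ v′ v (λ i → b′⪰b (suc i))

assign-⊒ : ∀ {n} (b : PartialAssignment n) i ℓ → lookup b i ≡ nothing → assign b i ℓ ⊒ b
assign-⊒ (x ∷ v) zero    ℓ refl = refines-free ∷ ⊒-refl
assign-⊒ (x ∷ v) (suc i) ℓ free = refines-refl ∷ assign-⊒ v i ℓ free

assign-mono-⊒ : ∀ {n} {b b′ : PartialAssignment n} i ℓ → b′ ⊒ b → assign b′ i ℓ ⊒ assign b i ℓ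
assign-mono-⊒ zero    ℓ (_ ∷ v′⊒v)    = refines-refl ∷ v′⊒v
assign-mono-⊒ (suc i) ℓ (x′⊒x ∷ v′⊒v) = x′⊒x ∷ assign-mono-⊒ i ℓ v′⊒v

allFree : ∀ n → PartialAssignment n
allFree n = replicate n nothing

⊒-allFree : ∀ {n} (b : PartialAssignment n) → b ⊒ allFree n
⊒-allFree []      = []
⊒-allFree (x ∷ v) = refines-free ∷ ⊒-allFree v

fill : ∀ {n} → Bool → PartialAssignment n → Vec Bool n
fill ℓ = map (fromMaybe ℓ)

refines-fill : ∀ ℓ x → Refines (just (fromMaybe ℓ x)) x
refines-fill ℓ nothing  = refines-free
refines-fill ℓ (just p) = refines-refl

total-fill-⊒ : ∀ {n} ℓ (b : PartialAssignment n) → total (fill ℓ b) ⊒ b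
total-fill-⊒ ℓ []      = []
total-fill-⊒ ℓ (x ∷ v) = refines-fill ℓ x ∷ total-fill-⊒ ℓ v

total-⊒⇒≡ : ∀ {n} {a a′ : Vec Bool n} → total a′ ⊒ total a → a′ ≡ a
total-⊒⇒≡ {a = []}    {[]}     []               = refl
total-⊒⇒≡ {a = p ∷ a} {p′ ∷ a′} (p′⊒p ∷ a′⊒a) with p′⊒p p refl
... | refl = cong (p ∷_) (total-⊒⇒≡ a′⊒a)

containsCertificate-total : ∀ {n} (f : Vec Bool n → Bool) a → ContainsCertificate f (total a)
containsCertificate-total f a =
  total a , (f a , λ a′ a′⪰a → cong f (total-⊒⇒≡ (⪰⇒⊒ (total a′) (total a) a′⪰a))) ,
  ⊒⇒⪰ (⊒-refl {b = total a})

Increasing : ∀ {n} → (Vec Bool n → Bool) → Set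
Increasing f = ∀ {a a′} → Pointwise _≤ᵇ_ a a′ → f a ≤ᵇ f a′

fill-false-≤ : ∀ {n} {b : PartialAssignment n} {a} → total a ⊒ b → Pointwise _≤ᵇ_ (fill false b) a
fill-false-≤ {b = []}          {[]}    []              = []
fill-false-≤ {b = nothing ∷ b} {p ∷ a} (_ ∷ a⊒b)     = Boolₚ.≤-minimum p ∷ fill-false-≤ a⊒b
fill-false-≤ {b = just q ∷ b}  {p ∷ a} (p⊒q ∷ a⊒b) with p⊒q q refl
... | refl = Boolₚ.≤-refl ∷ fill-false-≤ a⊒b

≤-fill-true : ∀ {n} {b : PartialAssignment n} {a} → total a ⊒ b → Pointwise _≤ᵇ_ a (fill true b)
≤-fill-true {b = []}          {[]}    []              = []
≤-fill-true {b = nothing ∷ b} {p ∷ a} (_ ∷ a⊒b)     = Boolₚ.≤-maximum p ∷ ≤-fill-true a⊒b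
≤-fill-true {b = just q ∷ b}  {p ∷ a} (p⊒q ∷ a⊒b) with p⊒q q refl
... | refl = Boolₚ.≤-refl ∷ ≤-fill-true a⊒b

≤-false : ∀ {p} → p ≤ᵇ false → p ≡ false
≤-false b≤b = refl

true-≤ : ∀ {p} → true ≤ᵇ p → p ≡ true
true-≤ b≤b = refl

containsCertificate⇔ : ∀ {n} {f : Vec Bool n → Bool} → Increasing f → ∀ b →
  ContainsCertificate f b ⇔ (f (fill true b) ≡ false ⊎ f (fill false b) ≡ true)
containsCertificate⇔ {f = f} increasing b = mk⇔ certificate⇒fill fill⇒certificate
  where
  extension : ∀ ℓ c → b ⪰ c → total (fill ℓ b) ⪰ c
  extension ℓ c b⪰c = ⊒⇒⪰ (⊒-trans (total-fill-⊒ ℓ b) (⪰⇒⊒ b c b⪰c))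

  certificate⇒fill : ContainsCertificate f b → f (fill true b) ≡ false ⊎ f (fill false b) ≡ true
  certificate⇒fill (c , (false , certificate) , b⪰c) = inj₁ (certificate _ (extension true c b⪰c))
  certificate⇒fill (c , (true  , certificate) , b⪰c) = inj₂ (certificate _ (extension false c b⪰c))

  fill⇒certificate : f (fill true b) ≡ false ⊎ f (fill false b) ≡ true → ContainsCertificate f b
  fill⇒certificate (inj₁ optimistic≡false) = b , (false , λ a a⪰b →
    ≤-false (subst (f a ≤ᵇ_) optimistic≡false (increasing (≤-fill-true (⪰⇒⊒ (total a) b a⪰b)))))
    , ⊒⇒⪰ (⊒-refl {b = b})
  fill⇒certificate (inj₂ pessimistic≡true) = b , (true , λ a a⪰b →
    true-≤ (subst (_≤ᵇ f a) pessimistic≡true (increasing (fill-false-≤ (⪰⇒⊒ (total a) b a⪰b)))))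
    , ⊒⇒⪰ (⊒-refl {b = b})

record AntitoneSupermodular {n} (R : PartialAssignment n → ℕ) : Set where
  field
    antitone     : ∀ {b b′} → b′ ⊒ b → R b′ ≤ R b
    supermodular : ∀ {b b′} i ℓ → b′ ⊒ b → lookup b i ≡ nothing → lookup b′ i ≡ nothing →
                   R (assign b i ℓ) + R b′ ≤ R (assign b′ i ℓ) + R b

open AntitoneSupermodular

decrement-≤ : ∀ {r rᵢ r′ r′ᵢ} → rᵢ + r′ ≤ r′ᵢ + r → r′ ∸ r′ᵢ ≤ r ∸ rᵢ
decrement-≤ {r} {rᵢ} {r′} {r′ᵢ} sup = begin
  r′ ∸ r′ᵢ                    ≡⟨ [m+n]∸[m+o]≡n∸o rᵢ r′ r′ᵢ ⟨
  (rᵢ + r′) ∸ (rᵢ + r′ᵢ)      ≤⟨ ∸-monoˡ-≤ (rᵢ + r′ᵢ) sup ⟩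
  (r′ᵢ + r) ∸ (rᵢ + r′ᵢ)      ≡⟨ cong ((r′ᵢ + r) ∸_) (+-comm rᵢ r′ᵢ) ⟩
  (r′ᵢ + r) ∸ (r′ᵢ + rᵢ)      ≡⟨ [m+n]∸[m+o]≡n∸o r′ᵢ r rᵢ ⟩
  r ∸ rᵢ                      ∎
  where open ≤-Reasoning

-- Each value is written as its lower neighbour plus a decrement, so that no subtraction occurs.
*-supermodular : ∀ {x x′ p p′ y y′ q q′} → x′ ≤ x → p′ ≤ p → y′ ≤ y → q′ ≤ q →
                 x * y + (x′ + p′) * (y′ + q′) ≤ x′ * y′ + (x + p) * (y + q)
*-supermodular {x} {x′} {p} {p′} {y} {y′} {q} {q′} x′≤x p′≤p y′≤y q′≤q = begin
  x * y + (x′ + p′) * (y′ + q′)                       ≡⟨ expand x y x′ p′ y′ q′ ⟩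
  (x * y + x′ * y′) + (x′ * q′ + p′ * y′ + p′ * q′)
    ≤⟨ +-monoʳ-≤ (x * y + x′ * y′)
         (+-mono-≤ (+-mono-≤ (*-mono-≤ x′≤x q′≤q) (*-mono-≤ p′≤p y′≤y)) (*-mono-≤ p′≤p q′≤q)) ⟩
  (x * y + x′ * y′) + (x * q + p * y + p * q)
    ≡⟨ cong (_+ (x * q + p * y + p * q)) (+-comm (x * y) (x′ * y′)) ⟩
  (x′ * y′ + x * y) + (x * q + p * y + p * q)         ≡⟨ expand x′ y′ x p y q ⟨
  x′ * y′ + (x + p) * (y + q)                         ∎
  where
  open ≤-Reasoning
  expand : ∀ a b c d e f → a * b + (c + d) * (e + f) ≡ (a * b + c * e) + (c * f + d * e + d * f)
  expand = solve-∀

module _ {n} {F G : PartialAssignment n → ℕ} where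

  as-cong : (∀ b → F b ≡ G b) → AntitoneSupermodular G → AntitoneSupermodular F
  as-cong F≗G asG .antitone {b} {b′} b′⊒b rewrite F≗G b | F≗G b′ = antitone asG b′⊒b
  as-cong F≗G asG .supermodular {b} {b′} i ℓ b′⊒b free free′
    rewrite F≗G b | F≗G b′ | F≗G (assign b i ℓ) | F≗G (assign b′ i ℓ) =
    supermodular asG i ℓ b′⊒b free free′

  as-+ : AntitoneSupermodular F → AntitoneSupermodular G → AntitoneSupermodular (λ b → F b + G b)
  as-+ asF asG .antitone b′⊒b = +-mono-≤ (antitone asF b′⊒b) (antitone asG b′⊒b)
  as-+ asF asG .supermodular {b} {b′} i ℓ b′⊒b free free′ = begin
    (F bᵢ + G bᵢ) + (F b′ + G b′)    ≡⟨ interchange (F bᵢ) _ _ _ ⟩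
    (F bᵢ + F b′) + (G bᵢ + G b′)
      ≤⟨ +-mono-≤ (supermodular asF i ℓ b′⊒b free free′) (supermodular asG i ℓ b′⊒b free free′) ⟩
    (F b′ᵢ + F b) + (G b′ᵢ + G b)    ≡⟨ interchange (F b′ᵢ) _ _ _ ⟩
    (F b′ᵢ + G b′ᵢ) + (F b + G b)    ∎
    where
    open ≤-Reasoning
    bᵢ = assign b i ℓ
    b′ᵢ = assign b′ i ℓ

  as-* : AntitoneSupermodular F → AntitoneSupermodular G → AntitoneSupermodular (λ b → F b * G b)
  as-* asF asG .antitone b′⊒b = *-mono-≤ (antitone asF b′⊒b) (antitone asG b′⊒b)
  as-* asF asG .supermodular {b} {b′} i ℓ b′⊒b free free′ = begin
    F bᵢ * G bᵢ + F b′ * G b′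
      ≡⟨ cong₂ (λ u v → F bᵢ * G bᵢ + u * v) (m+[n∸m]≡n (below asF)) (m+[n∸m]≡n (below asG)) ⟨
    F bᵢ * G bᵢ + (F b′ᵢ + (F b′ ∸ F b′ᵢ)) * (G b′ᵢ + (G b′ ∸ G b′ᵢ))
      ≤⟨ *-supermodular (antitone asF b′ᵢ⊒bᵢ) (decrement asF) (antitone asG b′ᵢ⊒bᵢ) (decrement asG) ⟩
    F b′ᵢ * G b′ᵢ + (F bᵢ + (F b ∸ F bᵢ)) * (G bᵢ + (G b ∸ G bᵢ))
      ≡⟨ cong₂ (λ u v → F b′ᵢ * G b′ᵢ + u * v) (m+[n∸m]≡n (above asF)) (m+[n∸m]≡n (above asG)) ⟩
    F b′ᵢ * G b′ᵢ + F b * G b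
      ∎
    where
    open ≤-Reasoning
    bᵢ = assign b i ℓ
    b′ᵢ = assign b′ i ℓ
    b′ᵢ⊒bᵢ = assign-mono-⊒ i ℓ b′⊒b
    above : ∀ {H} → AntitoneSupermodular H → H bᵢ ≤ H b
    above asH = antitone asH (assign-⊒ b i ℓ free)
    below : ∀ {H} → AntitoneSupermodular H → H b′ᵢ ≤ H b′
    below asH = antitone asH (assign-⊒ b′ i ℓ free′)
    decrement : ∀ {H} → AntitoneSupermodular H → H b′ ∸ H b′ᵢ ≤ H b ∸ H bᵢ
    decrement {H} asH = decrement-≤ {H b} {H bᵢ} {H b′} {H b′ᵢ} (supermodular asH i ℓ b′⊒b free free′)

as-const : ∀ {n} c → AntitoneSupermodular {n} (λ _ → c)
as-const c .antitone _ = ≤-refl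
as-const c .supermodular _ _ _ _ _ = ≤-refl

as-head : ∀ {n} (h : Maybe Bool → ℕ) → (∀ ℓ → h (just ℓ) ≤ h nothing) →
          AntitoneSupermodular {suc n} (λ b → h (head b))
as-head h h-antitone .antitone (x′⊒x ∷ _) = entry x′⊒x
  where
  entry : ∀ {x x′} → Refines x′ x → h x′ ≤ h x
  entry {nothing} {nothing} _    = ≤-refl
  entry {nothing} {just ℓ}  _    = h-antitone ℓ
  entry {just ℓ}            x′⊒x rewrite x′⊒x ℓ refl = ≤-refl
as-head h _ .supermodular {x ∷ _} {x′ ∷ _} zero    ℓ _ refl refl = ≤-refl
as-head h _ .supermodular {x ∷ _} {x′ ∷ _} (suc i) ℓ _ _    _    = ≤-reflexive (+-comm (h x) (h x′))

as-tail : ∀ {n} {R : PartialAssignment n → ℕ} → AntitoneSupermodular R →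
          AntitoneSupermodular {suc n} (λ b → R (tail b))
as-tail asR .antitone (_ ∷ v′⊒v) = antitone asR v′⊒v
as-tail {R = R} asR .supermodular {_ ∷ v} {_ ∷ v′} zero ℓ _ _ _ = ≤-reflexive (+-comm (R v) (R v′))
as-tail asR .supermodular (suc i) ℓ (_ ∷ v′⊒v) free free′ = supermodular asR i ℓ v′⊒v free free′

∸-submodular : ∀ {Q a b c d} → a ≤ Q → b ≤ Q → c ≤ Q → d ≤ Q → a + b ≤ c + d →
               (Q ∸ c) + (Q ∸ d) ≤ (Q ∸ a) + (Q ∸ b)
∸-submodular {Q} {a} {b} {c} {d} a≤Q b≤Q c≤Q d≤Q a+b≤c+d = +-cancelˡ-≤ (a + b) _ _ (begin
  (a + b) + ((Q ∸ c) + (Q ∸ d))     ≤⟨ +-monoˡ-≤ _ a+b≤c+d ⟩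
  (c + d) + ((Q ∸ c) + (Q ∸ d))     ≡⟨ complement c≤Q d≤Q ⟩
  Q + Q                             ≡⟨ complement a≤Q b≤Q ⟨
  (a + b) + ((Q ∸ a) + (Q ∸ b))     ∎)
  where
  open ≤-Reasoning
  complement : ∀ {x y} → x ≤ Q → y ≤ Q → (x + y) + ((Q ∸ x) + (Q ∸ y)) ≡ Q + Q
  complement {x} {y} x≤Q y≤Q =
    trans (interchange x y (Q ∸ x) (Q ∸ y)) (cong₂ _+_ (m+[n∸m]≡n x≤Q) (m+[n∸m]≡n y≤Q))

goalFunction : ∀ {n} {f : Vec Bool n → Bool} {R : PartialAssignment n → ℕ} {Q} →
  AntitoneSupermodular R → (∀ b → R b ≡ 0 ⇔ ContainsCertificate f b) → R (allFree n) ≡ Q →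
  IsGoalFunction f (λ b → Q ∸ R b) Q
goalFunction {n} {f} {R} {Q} asR R≡0⇔ R-allFree = record
  { monotone   = λ b i ℓ free → ∸-monoʳ-≤ Q (antitone asR (assign-⊒ b i ℓ free))
  ; submodular = λ b b′ i ℓ b′⪰b free free′ → ∸-submodular (R≤Q _) (R≤Q _) (R≤Q _) (R≤Q _)
                   (supermodular asR i ℓ (⪰⇒⊒ b′ b b′⪰b) free free′)
  ; total-goal = λ a → cong (Q ∸_) (from (R≡0⇔ (total a)) (containsCertificate-total f a))
  ; goal-iff   = λ b → mk⇔ (λ goal → to (R≡0⇔ b) (∸-cancelˡ-≡ (R≤Q b) z≤n goal))
                           (λ certificate → cong (Q ∸_) (from (R≡0⇔ b) certificate))
  }
  where
  R≤Q : ∀ b → R b ≤ Q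
  R≤Q b = subst (R b ≤_) R-allFree (antitone asR (⊒-allFree b))

freeCount : ∀ {n} → PartialAssignment n → ℕ
freeCount []            = 0
freeCount (nothing ∷ b) = suc (freeCount b)
freeCount (just _ ∷ b)  = freeCount b

freeCount-assign : ∀ {n} (b : PartialAssignment n) i ℓ → lookup b i ≡ nothing →
                   freeCount b ≡ suc (freeCount (assign b i ℓ))
freeCount-assign (x ∷ b)        zero    ℓ refl = refl
freeCount-assign (nothing ∷ b)  (suc i) ℓ free = cong suc (freeCount-assign b i ℓ free)
freeCount-assign (just _ ∷ b)   (suc i) ℓ free = freeCount-assign b i ℓ free

free-or-total : ∀ {n} (b : PartialAssignment n) →
                (Σ (Fin n) λ i → lookup b i ≡ nothing) ⊎ (Σ (Vec Bool n) λ a → b ≡ total a)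
free-or-total []            = inj₂ ([] , refl)
free-or-total (nothing ∷ b) = inj₁ (zero , refl)
free-or-total (just p ∷ b) with free-or-total b
... | inj₁ (i , free)  = inj₁ (suc i , free)
... | inj₂ (a , b≡a)   = inj₂ (p ∷ a , cong (just p ∷_) b≡a)

record Split {n} (L : PartialAssignment n → ℕ) (b : PartialAssignment n) : Set where
  field
    i        : Fin n
    ℓ        : Bool
    b′       : PartialAssignment n
    i-free   : lookup b i ≡ nothing
    i-free′  : lookup b′ i ≡ nothing
    b′⊒b     : b′ ⊒ b
    additive : L b ≡ L (assign b i ℓ) + L b′
    positive : 1 ≤ L (assign b i ℓ)
    positive′ : 1 ≤ L b′
    closes   : L (assign b′ i ℓ) ≡ 0

deficit-superadditive : ∀ {Q x y z l l′} → Q + x ≤ y + z → y + l ≤ Q → z + l′ ≤ Q → x + (l + l′) ≤ Q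
deficit-superadditive {Q} {x} {y} {z} {l} {l′} Q+x≤y+z y+l≤Q z+l′≤Q = +-cancelˡ-≤ Q _ _ (begin
  Q + (x + (l + l′))       ≡⟨ +-assoc Q x (l + l′) ⟨
  (Q + x) + (l + l′)       ≤⟨ +-monoˡ-≤ (l + l′) Q+x≤y+z ⟩
  (y + z) + (l + l′)       ≡⟨ interchange y z l l′ ⟩
  (y + l) + (z + l′)       ≤⟨ +-mono-≤ y+l≤Q z+l′≤Q ⟩
  Q + Q                    ∎)
  where open ≤-Reasoning

module _ {n} {f : Vec Bool n → Bool} {g : PartialAssignment n → ℕ} {Q} (G : IsGoalFunction f g Q) where
  open IsGoalFunction G

  ≤-goal : ∀ b → g b ≤ Q
  ≤-goal b = bounded b refl
    where
    bounded : ∀ b {m} → freeCount b ≡ m → g b ≤ Q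
    bounded b {m} count with free-or-total b
    ... | inj₂ (a , refl) = ≤-reflexive (total-goal a)
    bounded b {zero}  count | inj₁ (i , free) with () ← trans (sym (freeCount-assign b i false free)) count
    bounded b {suc m} count | inj₁ (i , free) = ≤-trans (monotone b i false free)
      (bounded (assign b i false) (suc-injective (trans (sym (freeCount-assign b i false free)) count)))

  potential-≤-deficit : (L : PartialAssignment n → ℕ) → (∀ b → L b ≡ 0 ⇔ ContainsCertificate f b) →
                        (∀ b → 2 ≤ L b → Split L b) → ∀ b → g b + L b ≤ Q
  potential-≤-deficit L L≡0⇔ split b = bound b (<-wellFounded (L b))
    where
    bound : ∀ b → Acc _<_ (L b) → g b + L b ≤ Q
    bound b (acc smaller) with L b in L-b
    ... | zero = ≤-trans (≤-reflexive (+-identityʳ (g b))) (≤-goal b)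
    ... | suc zero = subst (_≤ Q) (+-comm 1 (g b)) (≤∧≢⇒< (≤-goal b) uncertified)
      where
      uncertified : g b ≢ Q
      uncertified goal with () ← trans (sym L-b) (from (L≡0⇔ b) (to (goal-iff b) goal))
    ... | suc (suc m) = subst (λ l → g b + l ≤ Q) L≡
        (deficit-superadditive {y = g bᵢ} {z = g b′} {l = L bᵢ} {l′ = L b′} closing bᵢ-bound b′-bound)
      where
      open Split (split b (subst (2 ≤_) (sym L-b) (s≤s (s≤s z≤n))))
      bᵢ = assign b i ℓ
      L≡ : L bᵢ + L b′ ≡ suc (suc m)
      L≡ = trans (sym additive) L-b
      closing : Q + g b ≤ g bᵢ + g b′
      closing = subst (λ x → x + g b ≤ g bᵢ + g b′) (from (goal-iff _) (to (L≡0⇔ _) closes))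
                      (submodular b b′ i ℓ (⊒⇒⪰ b′⊒b) i-free i-free′)
      bᵢ-bound : g bᵢ + L bᵢ ≤ Q
      bᵢ-bound = bound bᵢ (smaller (subst (L bᵢ <_) L≡ (m<m+n _ positive′)))
      b′-bound : g b′ + L b′ ≤ Q
      b′-bound = bound b′ (smaller (subst (L b′ <_) L≡ (m<n+m _ positive)))

toℕ : Bool → ℕ
toℕ false = 0
toℕ true  = 1

toℕ-∧ : ∀ p q → toℕ (p ∧ q) ≡ toℕ p * toℕ q
toℕ-∧ false q = refl
toℕ-∧ true  q = sym (+-identityʳ (toℕ q))

toℕ≡0⇔ : ∀ {p} → toℕ p ≡ 0 ⇔ p ≡ false
toℕ≡0⇔ {false} = mk⇔ (λ _ → refl) (λ _ → refl)
toℕ≡0⇔ {true}  = mk⇔ (λ ()) (λ ())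

toℕ≤1 : ∀ p → toℕ p ≤ 1
toℕ≤1 false = z≤n
toℕ≤1 true  = ≤-refl

∧-mono-≤ᵇ : ∀ {p p′ q q′} → p ≤ᵇ p′ → q ≤ᵇ q′ → p ∧ q ≤ᵇ p′ ∧ q′
∧-mono-≤ᵇ f≤t          _    = Boolₚ.≤-minimum _
∧-mono-≤ᵇ (b≤b {false}) _    = b≤b
∧-mono-≤ᵇ (b≤b {true})  q≤q′ = q≤q′

∨-mono-≤ᵇ : ∀ {p p′ q q′} → p ≤ᵇ p′ → q ≤ᵇ q′ → p ∨ q ≤ᵇ p′ ∨ q′
∨-mono-≤ᵇ f≤t          _    = Boolₚ.≤-maximum _
∨-mono-≤ᵇ (b≤b {false}) q≤q′ = q≤q′
∨-mono-≤ᵇ (b≤b {true})  _    = b≤b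

∨≡true : ∀ p {q} → p ∨ q ≡ true → p ≡ true ⊎ q ≡ true
∨≡true false q≡true = inj₂ q≡true
∨≡true true  _      = inj₁ refl

term : Bool → Bool → Bool → Bool
term p q r = p ∧ q ∧ r

filledBlock : Bool → Maybe Bool → Maybe Bool → Maybe Bool → Bool
filledBlock ℓ x y z = term (fromMaybe ℓ x) (fromMaybe ℓ y) (fromMaybe ℓ z)

term-mono : ∀ {p p′ q q′ r r′} → p ≤ᵇ p′ → q ≤ᵇ q′ → r ≤ᵇ r′ → term p q r ≤ᵇ term p′ q′ r′
term-mono p≤p′ q≤q′ r≤r′ = ∧-mono-≤ᵇ p≤p′ (∧-mono-≤ᵇ q≤q′ r≤r′)

tribes-increasing : ∀ k → Increasing (tribes k)
tribes-increasing zero    []                      = b≤b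
tribes-increasing (suc k) (p≤ ∷ q≤ ∷ r≤ ∷ a≤a′) = ∨-mono-≤ᵇ (term-mono p≤ q≤ r≤) (tribes-increasing k a≤a′)

BlockWeight : Set
BlockWeight = Maybe Bool → Maybe Bool → Maybe Bool → ℕ

sumBlocks prodBlocks : BlockWeight → ∀ k → PartialAssignment (k * 3) → ℕ
sumBlocks  f zero    []                = 0
sumBlocks  f (suc k) (x ∷ y ∷ z ∷ v) = f x y z + sumBlocks f k v
prodBlocks f zero    []                = 1
prodBlocks f (suc k) (x ∷ y ∷ z ∷ v) = f x y z * prodBlocks f k v

canBeTrue canBeFalse : Maybe Bool → ℕ
canBeTrue  x = toℕ (fromMaybe true x)
canBeFalse x = toℕ (not (fromMaybe false x))

-- On a live block, unset counts exactly its free variables.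
alive unset width : BlockWeight
alive x y z = toℕ (filledBlock true x y z)
unset x y z = canBeFalse x + (canBeFalse y + canBeFalse z)
width x y z = if filledBlock true x y z then unset x y z else 1

sumBlocks≡0⇔ : ∀ {f} → (∀ x y z → f x y z ≡ 0 ⇔ filledBlock true x y z ≡ false) →
               ∀ k b → sumBlocks f k b ≡ 0 ⇔ tribes k (fill true b) ≡ false
sumBlocks≡0⇔ f≡0⇔ zero    []                = mk⇔ (λ _ → refl) (λ _ → refl)
sumBlocks≡0⇔ f≡0⇔ (suc k) (x ∷ y ∷ z ∷ v) = mk⇔
  (λ sum≡0 → cong₂ _∨_ (to (f≡0⇔ x y z) (m+n≡0⇒m≡0 _ sum≡0)) (to (sumBlocks≡0⇔ f≡0⇔ k v) (m+n≡0⇒n≡0 _ sum≡0)))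
  (λ tribes≡false → cong₂ _+_ (from (f≡0⇔ x y z) (Boolₚ.∨-conicalˡ _ _ tribes≡false))
                              (from (sumBlocks≡0⇔ f≡0⇔ k v) (Boolₚ.∨-conicalʳ _ _ tribes≡false)))

prodBlocks≡0⇔ : ∀ {f} → (∀ x y z → f x y z ≡ 0 ⇔ filledBlock false x y z ≡ true) →
                ∀ k b → prodBlocks f k b ≡ 0 ⇔ tribes k (fill false b) ≡ true
prodBlocks≡0⇔ f≡0⇔ zero    []                = mk⇔ (λ ()) (λ ())
prodBlocks≡0⇔ {f} f≡0⇔ (suc k) (x ∷ y ∷ z ∷ v) = mk⇔ to′ from′
  where
  to′ : f x y z * prodBlocks f k v ≡ 0 → filledBlock false x y z ∨ tribes k (fill false v) ≡ true
  to′ product≡0 with m*n≡0⇒m≡0∨n≡0 (f x y z) product≡0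
  ... | inj₁ block≡0 = cong (_∨ tribes k (fill false v)) (to (f≡0⇔ x y z) block≡0)
  ... | inj₂ rest≡0  =
    trans (cong (filledBlock false x y z ∨_) (to (prodBlocks≡0⇔ f≡0⇔ k v) rest≡0)) (Boolₚ.∨-zeroʳ _)
  from′ : filledBlock false x y z ∨ tribes k (fill false v) ≡ true → f x y z * prodBlocks f k v ≡ 0
  from′ tribes≡true with ∨≡true _ tribes≡true
  ... | inj₁ block≡true = cong (_* prodBlocks f k v) (from (f≡0⇔ x y z) block≡true)
  ... | inj₂ rest≡true  =
    trans (cong (f x y z *_) (from (prodBlocks≡0⇔ f≡0⇔ k v) rest≡true)) (*-zeroʳ (f x y z))

unset≡0⇔ : ∀ x y z → unset x y z ≡ 0 ⇔ filledBlock false x y z ≡ true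
unset≡0⇔ x y z = falses≡0⇔ (fromMaybe false x) (fromMaybe false y) (fromMaybe false z)
  where
  falses≡0⇔ : ∀ p q r → toℕ (not p) + (toℕ (not q) + toℕ (not r)) ≡ 0 ⇔ term p q r ≡ true
  falses≡0⇔ true  true  true  = mk⇔ (λ _ → refl) (λ _ → refl)
  falses≡0⇔ false _     _     = mk⇔ (λ ()) (λ ())
  falses≡0⇔ true  false _     = mk⇔ (λ ()) (λ ())
  falses≡0⇔ true  true  false = mk⇔ (λ ()) (λ ())

fromMaybe-≤ : ∀ x → fromMaybe false x ≤ᵇ fromMaybe true x
fromMaybe-≤ nothing  = f≤t
fromMaybe-≤ (just p) = b≤b

width≡0⇔ : ∀ x y z → width x y z ≡ 0 ⇔ filledBlock false x y z ≡ true
width≡0⇔ x y z = mk⇔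
  (λ width≡0 → to (unset≡0⇔ x y z) (unset≡0 (filledBlock true x y z) width≡0))
  (λ completed → subst (λ c → (if c then unset x y z else 1) ≡ 0) (sym (alive-if completed))
                       (from (unset≡0⇔ x y z) completed))
  where
  unset≡0 : ∀ c {n} → (if c then n else 1) ≡ 0 → n ≡ 0
  unset≡0 true n≡0 = n≡0
  alive-if : filledBlock false x y z ≡ true → filledBlock true x y z ≡ true
  alive-if completed = true-≤ (subst (_≤ᵇ filledBlock true x y z) completed
                                     (term-mono (fromMaybe-≤ x) (fromMaybe-≤ y) (fromMaybe-≤ z)))

liveCount unsetProduct widthProduct : ∀ k → PartialAssignment (k * 3) → ℕ
liveCount    = sumBlocks alive
unsetProduct = prodBlocks unset
widthProduct = prodBlocks width

product≡0⇔containsCertificate : ∀ {k} {F G : PartialAssignment (k * 3) → ℕ} →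
  (∀ b → F b ≡ 0 ⇔ tribes k (fill true b) ≡ false) → (∀ b → G b ≡ 0 ⇔ tribes k (fill false b) ≡ true) →
  ∀ b → F b * G b ≡ 0 ⇔ ContainsCertificate (tribes k) b
product≡0⇔containsCertificate {k} {F} {G} F≡0⇔ G≡0⇔ b = mk⇔
  (λ product≡0 → from certificate⇔ (Sum.map (to (F≡0⇔ b)) (to (G≡0⇔ b)) (m*n≡0⇒m≡0∨n≡0 (F b) product≡0)))
  (λ certificate → [ (λ optimistic → cong (_* G b) (from (F≡0⇔ b) optimistic))
                   , (λ pessimistic → trans (cong (F b *_) (from (G≡0⇔ b) pessimistic)) (*-zeroʳ (F b))) ]′
                   (to certificate⇔ certificate))
  where certificate⇔ = containsCertificate⇔ (tribes-increasing k) b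

liveCount≡0⇔ : ∀ k b → liveCount k b ≡ 0 ⇔ tribes k (fill true b) ≡ false
liveCount≡0⇔ = sumBlocks≡0⇔ (λ x y z → toℕ≡0⇔)

onBlock : ∀ {n} → BlockWeight → PartialAssignment (3 + n) → ℕ
onBlock f b = f (head b) (head (tail b)) (head (tail (tail b)))

as-sumBlocks : ∀ {f} → (∀ {n} → AntitoneSupermodular {3 + n} (onBlock f)) →
               ∀ k → AntitoneSupermodular (sumBlocks f k)
as-sumBlocks as-f zero    = as-cong (λ { [] → refl }) (as-const 0)
as-sumBlocks as-f (suc k) =
  as-cong (λ { (x ∷ y ∷ z ∷ v) → refl }) (as-+ as-f (as-tail (as-tail (as-tail (as-sumBlocks as-f k)))))

as-prodBlocks : ∀ {f} → (∀ {n} → AntitoneSupermodular {3 + n} (onBlock f)) →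
                ∀ k → AntitoneSupermodular (prodBlocks f k)
as-prodBlocks as-f zero    = as-cong (λ { [] → refl }) (as-const 1)
as-prodBlocks as-f (suc k) =
  as-cong (λ { (x ∷ y ∷ z ∷ v) → refl }) (as-* as-f (as-tail (as-tail (as-tail (as-prodBlocks as-f k)))))

as-alive : ∀ {n} → AntitoneSupermodular {3 + n} (onBlock alive)
as-alive = as-cong (λ { (x ∷ y ∷ z ∷ v) → alive≡product x y z })
  (as-* entry (as-tail (as-* entry (as-tail entry))))
  where
  entry : ∀ {n} → AntitoneSupermodular {suc n} (λ b → canBeTrue (head b))
  entry = as-head canBeTrue (λ ℓ → toℕ≤1 ℓ)
  alive≡product : ∀ x y z → alive x y z ≡ canBeTrue x * (canBeTrue y * canBeTrue z)
  alive≡product x y z =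
    trans (toℕ-∧ (fromMaybe true x) _) (cong (canBeTrue x *_) (toℕ-∧ (fromMaybe true y) _))

as-unset : ∀ {n} → AntitoneSupermodular {3 + n} (onBlock unset)
as-unset = as-+ entry (as-tail (as-+ entry (as-tail entry)))
  where
  entry : ∀ {n} → AntitoneSupermodular {suc n} (λ b → canBeFalse (head b))
  entry = as-head canBeFalse (λ ℓ → toℕ≤1 (not ℓ))

liveCount-allFree : ∀ k → liveCount k (allFree (k * 3)) ≡ k
liveCount-allFree zero    = refl
liveCount-allFree (suc k) = cong suc (liveCount-allFree k)

unsetProduct-allFree : ∀ k → unsetProduct k (allFree (k * 3)) ≡ 3 ^ k
unsetProduct-allFree zero    = refl
unsetProduct-allFree (suc k) = cong (3 *_) (unsetProduct-allFree k)

widthProduct-allFree : ∀ k → widthProduct k (allFree (k * 3)) ≡ 3 ^ k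
widthProduct-allFree zero    = refl
widthProduct-allFree (suc k) = cong (3 *_) (widthProduct-allFree k)

tribes-goalFunction : ∀ k →
  IsGoalFunction (tribes k) (λ b → 3 ^ k * k ∸ liveCount k b * unsetProduct k b) (3 ^ k * k)
tribes-goalFunction k = goalFunction
  (as-* (as-sumBlocks as-alive k) (as-prodBlocks as-unset k))
  (product≡0⇔containsCertificate {k} (liveCount≡0⇔ k) (prodBlocks≡0⇔ unset≡0⇔ k))
  (trans (cong₂ _*_ (liveCount-allFree k) (unsetProduct-allFree k)) (*-comm k (3 ^ k)))

potential : ∀ k → PartialAssignment (k * 3) → ℕ
potential k b = liveCount k b * widthProduct k b

potential≡0⇔ : ∀ k b → potential k b ≡ 0 ⇔ ContainsCertificate (tribes k) b
potential≡0⇔ k = product≡0⇔containsCertificate {k} (liveCount≡0⇔ k) (prodBlocks≡0⇔ width≡0⇔ k)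

data Wide : Maybe Bool → Maybe Bool → Maybe Bool → Set where
  ∗∗∗ : Wide nothing nothing nothing
  1∗∗ : Wide (just true) nothing nothing
  ∗1∗ : Wide nothing (just true) nothing
  ∗∗1 : Wide nothing nothing (just true)

data Narrow : Maybe Bool → Maybe Bool → Maybe Bool → Set where
  ∗11 : Narrow nothing (just true) (just true)
  1∗1 : Narrow (just true) nothing (just true)
  11∗ : Narrow (just true) (just true) nothing

data BlockView : Maybe Bool → Maybe Bool → Maybe Bool → Set where
  satisfied : BlockView (just true) (just true) (just true)
  dead      : ∀ {x y z} → alive x y z ≡ 0 → width x y z ≡ 1 → BlockView x y z
  wide      : ∀ {x y z} → Wide x y z → BlockView x y z
  narrow    : ∀ {x y z} → Narrow x y z → BlockView x y z

blockView : ∀ x y z → BlockView x y z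
blockView (just false) y            z            = dead refl refl
blockView nothing      (just false) z            = dead refl refl
blockView (just true)  (just false) z            = dead refl refl
blockView nothing      nothing      (just false) = dead refl refl
blockView nothing      (just true)  (just false) = dead refl refl
blockView (just true)  nothing      (just false) = dead refl refl
blockView (just true)  (just true)  (just false) = dead refl refl
blockView nothing      nothing      nothing      = wide ∗∗∗
blockView (just true)  nothing      nothing      = wide 1∗∗
blockView nothing      (just true)  nothing      = wide ∗1∗
blockView nothing      nothing      (just true)  = wide ∗∗1
blockView nothing      (just true)  (just true)  = narrow ∗11
blockView (just true)  nothing      (just true)  = narrow 1∗1
blockView (just true)  (just true)  nothing      = narrow 11∗
blockView (just true)  (just true)  (just true)  = satisfied

narrow-alive : ∀ {x y z} → Narrow x y z → alive x y z ≡ 1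
narrow-alive ∗11 = refl
narrow-alive 1∗1 = refl
narrow-alive 11∗ = refl

narrow-width : ∀ {x y z} → Narrow x y z → width x y z ≡ 1
narrow-width ∗11 = refl
narrow-width 1∗1 = refl
narrow-width 11∗ = refl

kill : Maybe Bool → Maybe Bool
kill x = just (fromMaybe false x)

narrow-kill : ∀ {x y z} → Narrow x y z →
              alive (kill x) (kill y) (kill z) ≡ 0 × width (kill x) (kill y) (kill z) ≡ 1
narrow-kill ∗11 = refl , refl
narrow-kill 1∗1 = refl , refl
narrow-kill 11∗ = refl , refl

*-positive : ∀ {m n} → 1 ≤ m → 1 ≤ n → 1 ≤ m * n
*-positive = *-mono-≤ {1} {_} {1}

*-positiveˡ : ∀ m {n} → 1 ≤ m * n → 1 ≤ m
*-positiveˡ (suc m) _ = s≤s z≤n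

*-positiveʳ : ∀ m {n} → 1 ≤ m * n → 1 ≤ n
*-positiveʳ m {n} 1≤mn = *-positiveˡ n (subst (1 ≤_) (*-comm m n) 1≤mn)

record FactorSplit {n} (F G : PartialAssignment n → ℕ) (b : PartialAssignment n) : Set where
  field
    split  : Split G b
    fixed  : F (assign b (Split.i split) (Split.ℓ split)) ≡ F b
    fixed′ : F (Split.b′ split) ≡ F b

module _ {n} {F G : PartialAssignment n → ℕ} {b : PartialAssignment n}
         (1≤F : 1 ≤ F b) (s : FactorSplit F G b) where
  open FactorSplit s
  open Split split

  private
    bᵢ = assign b i ℓ
    1≤F-bᵢ = subst (1 ≤_) (sym fixed) 1≤F
    1≤F-b′ = subst (1 ≤_) (sym fixed′) 1≤F

  toSplitʳ : Split (λ b → F b * G b) b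
  toSplitʳ = record
    { Split split
    ; additive  = begin
        F b * G b                     ≡⟨ cong (F b *_) additive ⟩
        F b * (G bᵢ + G b′)           ≡⟨ *-distribˡ-+ (F b) (G bᵢ) (G b′) ⟩
        F b * G bᵢ + F b * G b′       ≡⟨ cong₂ _+_ (cong (_* G bᵢ) fixed) (cong (_* G b′) fixed′) ⟨
        F bᵢ * G bᵢ + F b′ * G b′     ∎
    ; positive  = *-positive 1≤F-bᵢ positive
    ; positive′ = *-positive 1≤F-b′ positive′
    ; closes    = trans (cong (F (assign b′ i ℓ) *_) closes) (*-zeroʳ (F (assign b′ i ℓ)))
    }
    where open ≡-Reasoning

  toSplitˡ : Split (λ b → G b * F b) b
  toSplitˡ = record
    { Split split
    ; additive  = begin
        G b * F b                     ≡⟨ cong (_* F b) additive ⟩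
        (G bᵢ + G b′) * F b           ≡⟨ *-distribʳ-+ (F b) (G bᵢ) (G b′) ⟩
        G bᵢ * F b + G b′ * F b       ≡⟨ cong₂ _+_ (cong (G bᵢ *_) fixed) (cong (G b′ *_) fixed′) ⟨
        G bᵢ * F bᵢ + G b′ * F b′     ∎
    ; positive  = *-positive positive 1≤F-bᵢ
    ; positive′ = *-positive positive′ 1≤F-b′
    ; closes    = cong (_* F (assign b′ i ℓ)) closes
    }
    where open ≡-Reasoning

split-cons : ∀ {n x y z} {L : PartialAssignment n → ℕ} {L′ : PartialAssignment (3 + n) → ℕ} {v} →
             (∀ u → L′ (x ∷ y ∷ z ∷ u) ≡ L u) → Split L v → Split L′ (x ∷ y ∷ z ∷ v)
split-cons L′≡L s = record
  { i = suc (suc (suc i)) ; ℓ = ℓ ; b′ = _ ∷ _ ∷ _ ∷ b′ ; i-free = i-free ; i-free′ = i-free′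
  ; b′⊒b      = refines-refl ∷ refines-refl ∷ refines-refl ∷ b′⊒b
  ; additive  = trans (L′≡L _) (trans additive (cong₂ _+_ (sym (L′≡L _)) (sym (L′≡L _))))
  ; positive  = subst (1 ≤_) (sym (L′≡L _)) positive
  ; positive′ = subst (1 ≤_) (sym (L′≡L _)) positive′
  ; closes    = trans (L′≡L _) closes
  }
  where open Split s

liftSplit : ∀ {k x y z} {v : PartialAssignment (k * 3)} → 1 ≤ width x y z →
            FactorSplit (liveCount k) (widthProduct k) v →
            FactorSplit (liveCount (suc k)) (widthProduct (suc k)) (x ∷ y ∷ z ∷ v)
liftSplit {x = x} {y} {z} 1≤w s = record
  { split = record
    { i = suc (suc (suc i)) ; ℓ = ℓ ; b′ = x ∷ y ∷ z ∷ b′ ; i-free = i-free ; i-free′ = i-free′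
    ; b′⊒b      = refines-refl ∷ refines-refl ∷ refines-refl ∷ b′⊒b
    ; additive  = trans (cong (w *_) additive) (*-distribˡ-+ w _ _)
    ; positive  = *-positive 1≤w positive
    ; positive′ = *-positive 1≤w positive′
    ; closes    = trans (cong (w *_) closes) (*-zeroʳ w)
    }
  ; fixed  = cong (alive x y z +_) fixed
  ; fixed′ = cong (alive x y z +_) fixed′
  }
  where
  open FactorSplit s
  open Split split
  w = width x y z

-- Setting a free variable of a live block to 1 leaves a live block with one free variable
-- fewer; the extension sets the other free variables to 1 instead, and then x_i completes it.
wideSplit : ∀ {k x y z} {v : PartialAssignment (k * 3)} → Wide x y z → 1 ≤ widthProduct k v →
            FactorSplit (liveCount (suc k)) (widthProduct (suc k)) (x ∷ y ∷ z ∷ v)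
wideSplit {k} {v = v} ∗∗∗ 1≤W = record
  { split = record
    { i = zero ; ℓ = true ; b′ = nothing ∷ just true ∷ just true ∷ v ; i-free = refl ; i-free′ = refl
    ; b′⊒b = refines-refl ∷ refines-free ∷ refines-free ∷ ⊒-refl
    ; additive = *-distribʳ-+ (widthProduct k v) 2 1
    ; positive = *-positive {2} (s≤s z≤n) 1≤W ; positive′ = *-positive {1} (s≤s z≤n) 1≤W ; closes = refl }
  ; fixed = refl ; fixed′ = refl }
wideSplit {k} {v = v} 1∗∗ 1≤W = record
  { split = record
    { i = suc zero ; ℓ = true ; b′ = just true ∷ nothing ∷ just true ∷ v ; i-free = refl ; i-free′ = refl
    ; b′⊒b = refines-refl ∷ refines-refl ∷ refines-free ∷ ⊒-refl
    ; additive = *-distribʳ-+ (widthProduct k v) 1 1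
    ; positive = *-positive {1} (s≤s z≤n) 1≤W ; positive′ = *-positive {1} (s≤s z≤n) 1≤W ; closes = refl }
  ; fixed = refl ; fixed′ = refl }
wideSplit {k} {v = v} ∗1∗ 1≤W = record
  { split = record
    { i = zero ; ℓ = true ; b′ = nothing ∷ just true ∷ just true ∷ v ; i-free = refl ; i-free′ = refl
    ; b′⊒b = refines-refl ∷ refines-refl ∷ refines-free ∷ ⊒-refl
    ; additive = *-distribʳ-+ (widthProduct k v) 1 1
    ; positive = *-positive {1} (s≤s z≤n) 1≤W ; positive′ = *-positive {1} (s≤s z≤n) 1≤W ; closes = refl }
  ; fixed = refl ; fixed′ = refl }
wideSplit {k} {v = v} ∗∗1 1≤W = record
  { split = record
    { i = zero ; ℓ = true ; b′ = nothing ∷ just true ∷ just true ∷ v ; i-free = refl ; i-free′ = refl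
    ; b′⊒b = refines-refl ∷ refines-free ∷ refines-refl ∷ ⊒-refl
    ; additive = *-distribʳ-+ (widthProduct k v) 1 1
    ; positive = *-positive {1} (s≤s z≤n) 1≤W ; positive′ = *-positive {1} (s≤s z≤n) 1≤W ; closes = refl }
  ; fixed = refl ; fixed′ = refl }

kill-sum : ∀ {a a°} → a° ≡ 0 → suc a ≡ a + suc a°
kill-sum {a} refl = +-comm 1 a

-- Setting the only free variable of a live block to 0 kills the block; the extension kills
-- every other live block instead, and then x_i ← 0 leaves no live block at all.
narrowSplit : ∀ {k x y z} {v v° : PartialAssignment (k * 3)} → Narrow x y z → 1 ≤ liveCount k v →
              v° ⊒ v → liveCount k v° ≡ 0 → widthProduct k v° ≡ widthProduct k v →
              FactorSplit (widthProduct (suc k)) (liveCount (suc k)) (x ∷ y ∷ z ∷ v)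
narrowSplit {v° = v°} ∗11 1≤A v°⊒v dead° W° = record
  { split = record
    { i = zero ; ℓ = false ; b′ = nothing ∷ just true ∷ just true ∷ v° ; i-free = refl ; i-free′ = refl
    ; b′⊒b = refines-refl ∷ refines-refl ∷ refines-refl ∷ v°⊒v
    ; additive = kill-sum dead° ; positive = 1≤A ; positive′ = s≤s z≤n ; closes = dead° }
  ; fixed = refl ; fixed′ = cong (1 *_) W° }
narrowSplit {v° = v°} 1∗1 1≤A v°⊒v dead° W° = record
  { split = record
    { i = suc zero ; ℓ = false ; b′ = just true ∷ nothing ∷ just true ∷ v° ; i-free = refl ; i-free′ = refl
    ; b′⊒b = refines-refl ∷ refines-refl ∷ refines-refl ∷ v°⊒v
    ; additive = kill-sum dead° ; positive = 1≤A ; positive′ = s≤s z≤n ; closes = dead° }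
  ; fixed = refl ; fixed′ = cong (1 *_) W° }
narrowSplit {v° = v°} 11∗ 1≤A v°⊒v dead° W° = record
  { split = record
    { i = suc (suc zero) ; ℓ = false ; b′ = just true ∷ just true ∷ nothing ∷ v°
    ; i-free = refl ; i-free′ = refl
    ; b′⊒b = refines-refl ∷ refines-refl ∷ refines-refl ∷ v°⊒v
    ; additive = kill-sum dead° ; positive = 1≤A ; positive′ = s≤s z≤n ; closes = dead° }
  ; fixed = refl ; fixed′ = cong (1 *_) W° }

record Killable k (v : PartialAssignment (k * 3)) : Set where
  field
    width-one : widthProduct k v ≡ 1
    v°        : PartialAssignment (k * 3)
    v°⊒v      : v° ⊒ v
    dead°     : liveCount k v° ≡ 0
    width°    : widthProduct k v° ≡ 1

killable-cons : ∀ {k x y z x° y° z°} {v : PartialAssignment (k * 3)} →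
                Refines x° x → Refines y° y → Refines z° z → alive x° y° z° ≡ 0 → width x° y° z° ≡ 1 →
                width x y z ≡ 1 → Killable k v → Killable (suc k) (x ∷ y ∷ z ∷ v)
killable-cons {x° = x°} {y°} {z°} x°⊒x y°⊒y z°⊒z dead-block dead-width w≡1 κ = record
  { width-one = cong₂ _*_ w≡1 width-one
  ; v°        = x° ∷ y° ∷ z° ∷ v°
  ; v°⊒v      = x°⊒x ∷ y°⊒y ∷ z°⊒z ∷ v°⊒v
  ; dead°     = cong₂ _+_ dead-block dead°
  ; width°    = cong₂ _*_ dead-width width°
  }
  where open Killable κ

data Shape k (v : PartialAssignment (k * 3)) : Set where
  splittable : FactorSplit (liveCount k) (widthProduct k) v → Shape k v
  blocked    : widthProduct k v ≡ 0 → Shape k v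
  killable   : Killable k v → Shape k v

widthProduct-positive : ∀ {k} {v : PartialAssignment (k * 3)} →
                        FactorSplit (liveCount k) (widthProduct k) v → 1 ≤ widthProduct k v
widthProduct-positive s = subst (1 ≤_) (sym additive) (≤-trans positive (m≤m+n _ _))
  where open Split (FactorSplit.split s)

widthProduct-blocked : ∀ {k x y z} {v : PartialAssignment (k * 3)} →
                       widthProduct k v ≡ 0 → widthProduct (suc k) (x ∷ y ∷ z ∷ v) ≡ 0
widthProduct-blocked {x = x} {y} {z} W≡0 = trans (cong (width x y z *_) W≡0) (*-zeroʳ (width x y z))

classify : ∀ k (v : PartialAssignment (k * 3)) → Shape k v
classify zero    []                = killable (record
  { width-one = refl ; v° = [] ; v°⊒v = [] ; dead° = refl ; width° = refl })
classify (suc k) (x ∷ y ∷ z ∷ v) = extend (blockView x y z) (classify k v)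
  where
  extend : BlockView x y z → Shape k v → Shape (suc k) (x ∷ y ∷ z ∷ v)
  extend satisfied        _              = blocked refl
  extend _                (blocked W≡0)  = blocked (widthProduct-blocked {k} {x} {y} {z} W≡0)
  extend (dead _ w≡1)     (splittable s) = splittable (liftSplit (≤-reflexive (sym w≡1)) s)
  extend (dead a≡0 w≡1)   (killable κ)   =
    killable (killable-cons refines-refl refines-refl refines-refl a≡0 w≡1 w≡1 κ)
  extend (wide t)         (splittable s) = splittable (wideSplit t (widthProduct-positive {k} s))
  extend (wide t)         (killable κ)   =
    splittable (wideSplit t (≤-reflexive (sym (Killable.width-one κ))))
  extend (narrow t)       (splittable s) = splittable (liftSplit (≤-reflexive (sym (narrow-width t))) s)
  extend (narrow t)       (killable κ)   = killable (killable-cons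
    (refines-fill false x) (refines-fill false y) (refines-fill false z)
    (proj₁ (narrow-kill t)) (proj₂ (narrow-kill t)) (narrow-width t) κ)

dead-potential : ∀ {k x y z} → alive x y z ≡ 0 → width x y z ≡ 1 →
                 ∀ u → potential (suc k) (x ∷ y ∷ z ∷ u) ≡ potential k u
dead-potential {k} {x} {y} {z} a≡0 w≡1 u =
  cong₂ _*_ (cong (_+ liveCount k u) a≡0)
            (trans (cong (_* widthProduct k u) w≡1) (*-identityˡ (widthProduct k u)))

narrow-liveCount : ∀ {k x y z} {v : PartialAssignment (k * 3)} → Narrow x y z → widthProduct k v ≡ 1 →
                   2 ≤ potential (suc k) (x ∷ y ∷ z ∷ v) → 1 ≤ liveCount k v
narrow-liveCount {k} {x} {y} {z} {v} t W≡1 2≤L = ≤-pred (subst (2 ≤_) potential≡ 2≤L)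
  where
  potential≡ : potential (suc k) (x ∷ y ∷ z ∷ v) ≡ suc (liveCount k v)
  potential≡ = trans (cong₂ _*_ (cong (_+ liveCount k v) (narrow-alive t)) (cong₂ _*_ (narrow-width t) W≡1))
                     (*-identityʳ (suc (liveCount k v)))

findSplit : ∀ k (b : PartialAssignment (k * 3)) → 2 ≤ potential k b → Split (potential k) b
findSplit zero    []                ()
findSplit (suc k) (x ∷ y ∷ z ∷ v) 2≤L = byHead (blockView x y z)
  where
  b = x ∷ y ∷ z ∷ v
  1≤A : 1 ≤ liveCount (suc k) b
  1≤A = *-positiveˡ (liveCount (suc k) b) (≤-trans (s≤s z≤n) 2≤L)
  1≤W : 1 ≤ widthProduct (suc k) b
  1≤W = *-positiveʳ (liveCount (suc k) b) (≤-trans (s≤s z≤n) 2≤L)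

  byHead : BlockView x y z → Split (potential (suc k)) b
  byHead satisfied with () ← subst (2 ≤_) (*-zeroʳ (suc (liveCount k v))) 2≤L
  byHead (dead a≡0 w≡1) = split-cons tail-potential (findSplit k v (subst (2 ≤_) (tail-potential v) 2≤L))
    where tail-potential = dead-potential {k} {x} {y} {z} a≡0 w≡1
  byHead (wide t) = toSplitʳ 1≤A (wideSplit t (*-positiveʳ (width x y z) 1≤W))
  byHead (narrow t) with classify k v
  ... | splittable s = toSplitʳ 1≤A (liftSplit (≤-reflexive (sym (narrow-width t))) s)
  ... | blocked W≡0 with () ← subst (1 ≤_) (widthProduct-blocked {k} {x} {y} {z} W≡0) 1≤W
  ... | killable κ = toSplitˡ 1≤W
    (narrowSplit t (narrow-liveCount {k} t width-one 2≤L) v°⊒v dead° (trans width° (sym width-one)))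
    where open Killable κ

tribes-goalValue-≥ : ∀ k {g Q} → IsGoalFunction (tribes k) g Q → 3 ^ k * k ≤ Q
tribes-goalValue-≥ k {g} {Q} G = subst (_≤ Q) potential-allFree
  (≤-trans (m≤n+m _ _)
           (potential-≤-deficit G (potential k) (potential≡0⇔ k) (findSplit k) (allFree (k * 3))))
  where
  potential-allFree : potential k (allFree (k * 3)) ≡ 3 ^ k * k
  potential-allFree = trans (cong₂ _*_ (liveCount-allFree k) (widthProduct-allFree k)) (*-comm k (3 ^ k))

proposition5 : ∀ (k : ℕ) → 1 ≤ k → Γ≡ (tribes k) ((3 ^ k) * k)
proposition5 k _ = (_ , tribes-goalFunction k) , λ g Q G → tribes-goalValue-≥ k G
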